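{- Let $G$ be a monograph with signature $S$ and let $r\ge 1$ be such that $S$ has at least $r$ non-negative elements. Then the vertex labeled by the $r$-th largest non-negative element of $S$ is adjacent to at most $r-1$ vertices labeled by negative elements of $S$.
   Context: A finite simple graph $G=(V,E)$ is an autograph with signature $S$ (a finite multiset of integers) if there is a bijection $\pi$ from the elements of $S$ to $V$ such that for any two distinct elements $s,t$ of $S$, $\pi(s)$ and $\pi(t)$ are adjacent iff $|s-t|\in S$. $G$ is a monograph if it has a signature $S$ that is a set (all elements distinct). The vertex labeled by $s\in S$ is $\pi(s)$. -}

module Defs where

open import Data.Nat using (ℕ)
open import Data.Fin using (Fin)
open import Data.Integer using (ℤ; _-_; ∣_∣; +_; _<_; _≤_; _<?_; _≤?_)
open import Data.List using (List; length; filter)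
open import Data.Fin.Base using ()
open import Data.List.Base using ()
open import Data.Vec.Functional using ()
open import Data.Product using (Σ; ∃; _×_)
open import Function.Definitions using (Injective)
open import Relation.Binary.PropositionalEquality using (_≡_)
open import Relation.Nullary using (¬_)
open import Function.Bundles using (_⇔_)
open import Data.List using (allFin)

record SimpleGraph (n : ℕ) : Set₁ where
  field
    Adj     : Fin n → Fin n → Set
    symm    : ∀ {u v} → Adj u v → Adj v u
    irrefl  : ∀ {v} → ¬ Adj v v
open SimpleGraph public

InSig : ∀ {n} → (Fin n → ℤ) → ℤ → Set
InSig {n} ℓ s = ∃ λ (w : Fin n) → ℓ w ≡ s

-- ℓ : V → ℤ is the inverse of the bijection π : S → V.  G is a monograph
-- with signature S = {ℓ v} iff ℓ is injective (S is a set, π a bijection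
-- onto V) and distinct u, v are adjacent iff |ℓ u - ℓ v| ∈ S.
IsMonographLabelling : ∀ {n} → SimpleGraph n → (Fin n → ℤ) → Set
IsMonographLabelling {n} G ℓ =
  Injective _≡_ _≡_ ℓ ×
  (∀ (u v : Fin n) → ¬ (u ≡ v) → (Adj G u v ⇔ InSig ℓ (+ ∣ ℓ u - ℓ v ∣)))

-- number of vertices whose label is non-negative (= number of non-negative
-- elements of S)
numNonNeg : ∀ {n} → (Fin n → ℤ) → ℕ
numNonNeg {n} ℓ = length (filter (λ w → + 0 ≤? ℓ w) (allFin n))

numAbove : ∀ {n} → (Fin n → ℤ) → Fin n → ℕ
numAbove {n} ℓ v = length (filter (λ w → ℓ v <? ℓ w) (allFin n))

module Submission where

-- Let v carry a label ℓ v ≥ 0 and let w be a neighbour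
-- of v with ℓ w < 0.  By the monograph property |ℓ v - ℓ w| = ℓ v - ℓ w is
-- itself a label, say of the vertex u; and ℓ u = ℓ v - ℓ w > ℓ v.  Distinct
-- negative neighbours w give distinct labels ℓ v - ℓ w, hence distinct u.
-- So the negative neighbours of v inject into the vertices whose label
-- exceeds ℓ v; for the r-th largest non-negative label there are exactly
-- r - 1 of those.

open import Defs
open import Data.Nat using (ℕ; _≤_; _∸_; suc; z≤n; s≤s)
open import Data.Fin using (Fin)
open import Data.Integer using (ℤ; +_; _-_; -_; ∣_∣; _<?_) renaming (_≤_ to _≤ℤ_; _<_ to _<ℤ_)
import Data.Integer.Properties as ℤ
open import Data.List using (List; length; []; _∷_; filter; allFin)
open import Data.List.Relation.Unary.All using (All; []; _∷_) renaming (map to mapAll)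
open import Data.List.Relation.Unary.Any using (here; there)
open import Data.List.Relation.Unary.AllPairs using ([]; _∷_)
open import Data.List.Relation.Unary.Unique.Propositional using (Unique)
open import Data.List.Membership.Propositional using (_∈_)
open import Data.List.Membership.Propositional.Properties using (∈-filter⁺; ∈-allFin)
open import Data.Product using (∃; _×_; _,_; proj₁; proj₂)
open import Relation.Binary.PropositionalEquality using (_≡_; refl; sym; trans; cong; subst)
open import Relation.Nullary using (¬_)
open import Data.Empty using (⊥-elim)
open import Function.Bundles using (Equivalence)
open import Function.Definitions using (Injective)
open import Algebra.Bundles using (AbelianGroup)
open import Algebra.Properties.Group (AbelianGroup.group ℤ.+-0-abelianGroup) using (∙-cancelˡ)

module _ {A : Set} where

  remove : ∀ {x : A} (ys : List A) → x ∈ ys → List A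
  remove (_ ∷ ys) (here _)  = ys
  remove (y ∷ ys) (there p) = y ∷ remove ys p

  length-remove : ∀ {x : A} (ys : List A) (p : x ∈ ys) →
                  suc (length (remove ys p)) ≡ length ys
  length-remove (_ ∷ ys) (here _)  = refl
  length-remove (y ∷ ys) (there p) = cong suc (length-remove ys p)

  ∈-remove : ∀ {x y : A} (ys : List A) (p : x ∈ ys) →
             y ∈ ys → ¬ (y ≡ x) → y ∈ remove ys p
  ∈-remove (_ ∷ ys) (here refl) (here refl) y≢x = ⊥-elim (y≢x refl)
  ∈-remove (_ ∷ ys) (here refl) (there q)   y≢x = q
  ∈-remove (_ ∷ ys) (there p)   (here refl) y≢x = here refl
  ∈-remove (_ ∷ ys) (there p)   (there q)   y≢x = there (∈-remove ys p q y≢x)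

-- If each element of a duplicate-free list xs has an R-partner in ys, and
-- R is injective in its first argument, then xs is no longer than ys.
-- (Proof: match the head of xs with its partner y, delete y from ys; the
-- partners of the remaining elements differ from y by injectivity.)
pigeonhole : ∀ {A B : Set} (R : A → B → Set) →
             (∀ {x x′ y} → R x y → R x′ y → x ≡ x′) →
             ∀ (xs : List A) (ys : List B) → Unique xs →
             All (λ x → ∃ λ y → y ∈ ys × R x y) xs →
             length xs ≤ length ys
pigeonhole R injective [] ys _ _ = z≤n
pigeonhole R injective (x ∷ xs) ys (x∉xs ∷ unique) ((y , y∈ys , Rxy) ∷ partners) =
  subst (suc (length xs) ≤_) (length-remove ys y∈ys)
    (s≤s (pigeonhole R injective xs (remove ys y∈ys) unique (shrink x∉xs partners)))
  where
  shrink : ∀ {zs} → All (λ z → ¬ (x ≡ z)) zs →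
           All (λ z → ∃ λ y′ → y′ ∈ ys × R z y′) zs →
           All (λ z → ∃ λ y′ → y′ ∈ remove ys y∈ys × R z y′) zs
  shrink [] [] = []
  shrink (x≢z ∷ x≢zs) ((y′ , y′∈ys , Rzy′) ∷ rest) =
    (y′ , ∈-remove ys y∈ys y′∈ys (λ { refl → x≢z (injective Rxy Rzy′) }) , Rzy′)
    ∷ shrink x≢zs rest

<-minus-negative : ∀ (i j : ℤ) → j <ℤ + 0 → i <ℤ i - j
<-minus-negative i j j<0 =
  subst (_<ℤ i - j) (ℤ.+-identityʳ i) (ℤ.+-monoʳ-< i (ℤ.neg-mono-< j<0))

minus-injectiveʳ : ∀ (i j k : ℤ) → i - j ≡ i - k → j ≡ k
minus-injectiveʳ i j k eq = ℤ.neg-injective (∙-cancelˡ i (- j) (- k) eq)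

above : ∀ {n} → (Fin n → ℤ) → Fin n → List (Fin n)
above {n} ℓ v = filter (λ w → ℓ v <? ℓ w) (allFin n)

-- A neighbour w of a vertex v with ℓ v ≥ 0 > ℓ w determines a vertex u
-- above v with label ℓ v - ℓ w, since |ℓ v - ℓ w| ∈ S and ℓ v - ℓ w > ℓ v.
negative-neighbour-partner : ∀ {n} {G : SimpleGraph n} {ℓ : Fin n → ℤ} →
  IsMonographLabelling G ℓ → ∀ {v w : Fin n} → + 0 ≤ℤ ℓ v →
  ℓ w <ℤ + 0 × Adj G v w → ∃ λ u → u ∈ above ℓ v × ℓ u ≡ ℓ v - ℓ w
negative-neighbour-partner {n} {G} {ℓ} monograph {v} {w} 0≤ℓv (ℓw<0 , v~w) =
  u , ∈-filter⁺ (λ x → ℓ v <? ℓ x) (∈-allFin u) ℓv<ℓu , ℓu≡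
  where
  v≢w : ¬ (v ≡ w)
  v≢w refl = irrefl G v~w
  difference-in-signature : InSig ℓ (+ ∣ ℓ v - ℓ w ∣)
  difference-in-signature = Equivalence.to (proj₂ monograph v w v≢w) v~w
  u : Fin n
  u = proj₁ difference-in-signature
  ℓv<ℓv-ℓw : ℓ v <ℤ ℓ v - ℓ w
  ℓv<ℓv-ℓw = <-minus-negative (ℓ v) (ℓ w) ℓw<0
  ℓu≡ : ℓ u ≡ ℓ v - ℓ w
  ℓu≡ = trans (proj₂ difference-in-signature)
              (ℤ.0≤i⇒+∣i∣≡i (ℤ.≤-trans 0≤ℓv (ℤ.<⇒≤ ℓv<ℓv-ℓw)))
  ℓv<ℓu : ℓ v <ℤ ℓ u
  ℓv<ℓu = subst (ℓ v <ℤ_) (sym ℓu≡) ℓv<ℓv-ℓw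

partner-injective : ∀ {n} {ℓ : Fin n → ℤ} → Injective _≡_ _≡_ ℓ →
  ∀ {v w w′ u : Fin n} → ℓ u ≡ ℓ v - ℓ w → ℓ u ≡ ℓ v - ℓ w′ → w ≡ w′
partner-injective {ℓ = ℓ} ℓ-injective {v} {w} {w′} eq eq′ =
  ℓ-injective (minus-injectiveʳ (ℓ v) (ℓ w) (ℓ w′) (trans (sym eq) eq′))

-- The theorem.
lemma1 : ∀ (n : ℕ) (G : SimpleGraph n) (ℓ : Fin n → ℤ) →
    IsMonographLabelling G ℓ →
    ∀ (r : ℕ) → 1 ≤ r → r ≤ numNonNeg ℓ →
    ∀ (v : Fin n) → + 0 ≤ℤ ℓ v → numAbove ℓ v ≡ r ∸ 1 →
    ∀ (ws : List (Fin n)) → Unique ws →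
    All (λ w → (ℓ w <ℤ + 0) × Adj G v w) ws →
    length ws ≤ r ∸ 1
lemma1 n G ℓ monograph r _ _ v 0≤ℓv numAbove≡ ws unique negNeighbours =
  subst (length ws ≤_) numAbove≡
    (pigeonhole (λ w u → ℓ u ≡ ℓ v - ℓ w)
                (partner-injective (proj₁ monograph))
                ws (above ℓ v) unique
                (mapAll
                   (negative-neighbour-partner {G = G} monograph 0≤ℓv) negNeighbours))
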